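{- Let $T$ be a finite tournament that is not transitive and that contains none of the tournaments $W_4$, $L_4$ and $C_5$ as a subtournament (i.e., no subset of vertices of $T$ induces a tournament isomorphic to $W_4$, $L_4$ or $C_5$). Then $T$ is isomorphic to $T[a,b,c]$ for some positive integers $a,b,c$.
   Context: A tournament is an orientation of a complete graph. $W_4$ is the $4$-vertex tournament with one vertex being a source and the remaining three vertices forming a cyclically oriented triangle. $L_4$ is the $4$-vertex tournament with one vertex being a sink and the remaining three vertices forming a cyclically oriented triangle. $C_5$ is the $5$-vertex carousel tournament: its vertex set is $\mathbb{Z}_5$ and $uv$ is an edge iff $v-u\equiv 1$ or $v-u\equiv 2 \pmod 5$. For positive integers $a,b,c$, the digraph $C[a,b,c]$ has three disjoint vertex parts of sizes $a$, $b$, $c$, with all edges between the $a$-part and the $b$-part directed to the $b$-part, all edges between the $b$-part and the $c$-part directed to the $c$-part, all edges between the $c$-part and the $a$-part directed to the $a$-part, and no edges inside parts. The tournament $T[a,b,c]$ is obtained from $C[a,b,c]$ by adding a transitive tournament on the vertex set of each of the three parts. -}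

module Defs where

open import Level using (Level; _⊔_; suc; 0ℓ)
open import Data.Nat using (ℕ; NonZero)
open import Data.Fin using (Fin; zero; suc; _<_)
open import Data.Fin.Patterns
open import Data.Sum using (_⊎_; inj₁; inj₂)
open import Data.Product using (_×_; _,_; Σ; ∃)
open import Data.Empty using (⊥)
open import Data.Unit using (⊤)
open import Relation.Nullary using (¬_; Dec; yes; no)
open import Relation.Binary.PropositionalEquality using (_≡_; _≢_)
open import Function.Bundles using (_⤖_; Bijection)
open import Function.Definitions using (Injective)

record Tournament (V : Set) : Set₁ where
  field
    arc    : V → V → Set
    irrefl : ∀ {u} → ¬ arc u u
    asym   : ∀ {u v} → arc u v → ¬ arc v u
    total  : ∀ {u v} → u ≢ v → arc u v ⊎ arc v u
    dec    : ∀ u v → Dec (arc u v)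
open Tournament public

IsTransitive : ∀ {V} → Tournament V → Set
IsTransitive {V} T = ∀ {u v w : V} → arc T u v → arc T v w → arc T u w

_≅_ : ∀ {V W} → Tournament V → Tournament W → Set
_≅_ {V} {W} S T =
  Σ (V ⤖ W) λ f → ∀ u v →
    (arc S u v → arc T (Bijection.to f u) (Bijection.to f v)) ×
    (arc T (Bijection.to f u) (Bijection.to f v) → arc S u v)

-- H is (isomorphic to) a subtournament of T: an injective map of vertices
-- under which the arcs of H are exactly the arcs of T between the images.
-- (Equivalently: some vertex subset of T induces a tournament isomorphic to H.)
_⊑_ : ∀ {U V} → Tournament U → Tournament V → Set
_⊑_ {U} {V} H T =
  Σ (U → V) λ f → Injective _≡_ _≡_ f × (∀ u v →
    (arc H u v → arc T (f u) (f v)) × (arc T (f u) (f v) → arc H u v))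

data W₄-arc : Fin 4 → Fin 4 → Set where
  s1 : W₄-arc 0F 1F
  s2 : W₄-arc 0F 2F
  s3 : W₄-arc 0F 3F
  c12 : W₄-arc 1F 2F
  c23 : W₄-arc 2F 3F
  c31 : W₄-arc 3F 1F

data L₄-arc : Fin 4 → Fin 4 → Set where
  s1 : L₄-arc 1F 0F
  s2 : L₄-arc 2F 0F
  s3 : L₄-arc 3F 0F
  c12 : L₄-arc 1F 2F
  c23 : L₄-arc 2F 3F
  c31 : L₄-arc 3F 1F

-- C₅: vertex set ℤ₅, u → v iff v - u ≡ 1 or 2 (mod 5).
data C₅-arc : Fin 5 → Fin 5 → Set where
  a01 : C₅-arc 0F 1F
  a12 : C₅-arc 1F 2F
  a23 : C₅-arc 2F 3F
  a34 : C₅-arc 3F 4F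
  a40 : C₅-arc 4F 0F
  b02 : C₅-arc 0F 2F
  b13 : C₅-arc 1F 3F
  b24 : C₅-arc 2F 4F
  b30 : C₅-arc 3F 0F
  b41 : C₅-arc 4F 1F

W₄-total : ∀ {u v} → u ≢ v → W₄-arc u v ⊎ W₄-arc v u
W₄-total {0F} {0F} ne with ne _≡_.refl
... | ()
W₄-total {0F} {1F} _ = inj₁ s1
W₄-total {0F} {2F} _ = inj₁ s2
W₄-total {0F} {3F} _ = inj₁ s3
W₄-total {1F} {0F} _ = inj₂ s1
W₄-total {1F} {1F} ne with ne _≡_.refl
... | ()
W₄-total {1F} {2F} _ = inj₁ c12
W₄-total {1F} {3F} _ = inj₂ c31
W₄-total {2F} {0F} _ = inj₂ s2
W₄-total {2F} {1F} _ = inj₂ c12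
W₄-total {2F} {2F} ne with ne _≡_.refl
... | ()
W₄-total {2F} {3F} _ = inj₁ c23
W₄-total {3F} {0F} _ = inj₂ s3
W₄-total {3F} {1F} _ = inj₁ c31
W₄-total {3F} {2F} _ = inj₂ c23
W₄-total {3F} {3F} ne with ne _≡_.refl
... | ()

L₄-total : ∀ {u v} → u ≢ v → L₄-arc u v ⊎ L₄-arc v u
L₄-total {0F} {0F} ne with ne _≡_.refl
... | ()
L₄-total {0F} {1F} _ = inj₂ s1
L₄-total {0F} {2F} _ = inj₂ s2
L₄-total {0F} {3F} _ = inj₂ s3
L₄-total {1F} {0F} _ = inj₁ s1
L₄-total {1F} {1F} ne with ne _≡_.refl
... | ()
L₄-total {1F} {2F} _ = inj₁ c12
L₄-total {1F} {3F} _ = inj₂ c31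
L₄-total {2F} {0F} _ = inj₁ s2
L₄-total {2F} {1F} _ = inj₂ c12
L₄-total {2F} {2F} ne with ne _≡_.refl
... | ()
L₄-total {2F} {3F} _ = inj₁ c23
L₄-total {3F} {0F} _ = inj₁ s3
L₄-total {3F} {1F} _ = inj₁ c31
L₄-total {3F} {2F} _ = inj₂ c23
L₄-total {3F} {3F} ne with ne _≡_.refl
... | ()

C₅-total : ∀ {u v} → u ≢ v → C₅-arc u v ⊎ C₅-arc v u
C₅-total {0F} {0F} ne with ne _≡_.refl
... | ()
C₅-total {0F} {1F} _ = inj₁ a01
C₅-total {0F} {2F} _ = inj₁ b02
C₅-total {0F} {3F} _ = inj₂ b30
C₅-total {0F} {4F} _ = inj₂ a40
C₅-total {1F} {0F} _ = inj₂ a01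
C₅-total {1F} {1F} ne with ne _≡_.refl
... | ()
C₅-total {1F} {2F} _ = inj₁ a12
C₅-total {1F} {3F} _ = inj₁ b13
C₅-total {1F} {4F} _ = inj₂ b41
C₅-total {2F} {0F} _ = inj₂ b02
C₅-total {2F} {1F} _ = inj₂ a12
C₅-total {2F} {2F} ne with ne _≡_.refl
... | ()
C₅-total {2F} {3F} _ = inj₁ a23
C₅-total {2F} {4F} _ = inj₁ b24
C₅-total {3F} {0F} _ = inj₁ b30
C₅-total {3F} {1F} _ = inj₂ b13
C₅-total {3F} {2F} _ = inj₂ a23
C₅-total {3F} {3F} ne with ne _≡_.refl
... | ()
C₅-total {3F} {4F} _ = inj₁ a34
C₅-total {4F} {0F} _ = inj₁ a40
C₅-total {4F} {1F} _ = inj₁ b41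
C₅-total {4F} {2F} _ = inj₂ b24
C₅-total {4F} {3F} _ = inj₂ a34
C₅-total {4F} {4F} ne with ne _≡_.refl
... | ()

decW : ∀ u v → Dec (W₄-arc u v)
decW 0F 0F = no λ ()
decW 0F 1F = yes s1
decW 0F 2F = yes s2
decW 0F 3F = yes s3
decW 1F 0F = no λ ()
decW 1F 1F = no λ ()
decW 1F 2F = yes c12
decW 1F 3F = no λ ()
decW 2F 0F = no λ ()
decW 2F 1F = no λ ()
decW 2F 2F = no λ ()
decW 2F 3F = yes c23
decW 3F 0F = no λ ()
decW 3F 1F = yes c31
decW 3F 2F = no λ ()
decW 3F 3F = no λ ()

decL : ∀ u v → Dec (L₄-arc u v)
decL 0F 0F = no λ ()
decL 0F 1F = no λ ()
decL 0F 2F = no λ ()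
decL 0F 3F = no λ ()
decL 1F 0F = yes s1
decL 1F 1F = no λ ()
decL 1F 2F = yes c12
decL 1F 3F = no λ ()
decL 2F 0F = yes s2
decL 2F 1F = no λ ()
decL 2F 2F = no λ ()
decL 2F 3F = yes c23
decL 3F 0F = yes s3
decL 3F 1F = yes c31
decL 3F 2F = no λ ()
decL 3F 3F = no λ ()

decC : ∀ u v → Dec (C₅-arc u v)
decC 0F 0F = no λ ()
decC 0F 1F = yes a01
decC 0F 2F = yes b02
decC 0F 3F = no λ ()
decC 0F 4F = no λ ()
decC 1F 0F = no λ ()
decC 1F 1F = no λ ()
decC 1F 2F = yes a12
decC 1F 3F = yes b13
decC 1F 4F = no λ ()
decC 2F 0F = no λ ()
decC 2F 1F = no λ ()
decC 2F 2F = no λ ()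
decC 2F 3F = yes a23
decC 2F 4F = yes b24
decC 3F 0F = yes b30
decC 3F 1F = no λ ()
decC 3F 2F = no λ ()
decC 3F 3F = no λ ()
decC 3F 4F = yes a34
decC 4F 0F = yes a40
decC 4F 1F = yes b41
decC 4F 2F = no λ ()
decC 4F 3F = no λ ()
decC 4F 4F = no λ ()

W₄ : Tournament (Fin 4)
W₄ = record { arc = W₄-arc ; irrefl = λ () ; asym = asy ; total = W₄-total ; dec = decW }
  where
  asy : ∀ {u v} → W₄-arc u v → ¬ W₄-arc v u
  asy s1 ()
  asy s2 ()
  asy s3 ()
  asy c12 ()
  asy c23 ()
  asy c31 ()

L₄ : Tournament (Fin 4)
L₄ = record { arc = L₄-arc ; irrefl = λ () ; asym = asy ; total = L₄-total ; dec = decL }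
  where
  asy : ∀ {u v} → L₄-arc u v → ¬ L₄-arc v u
  asy s1 ()
  asy s2 ()
  asy s3 ()
  asy c12 ()
  asy c23 ()
  asy c31 ()

C₅ : Tournament (Fin 5)
C₅ = record { arc = C₅-arc ; irrefl = λ () ; asym = asy ; total = C₅-total ; dec = decC }
  where
  asy : ∀ {u v} → C₅-arc u v → ¬ C₅-arc v u
  asy a01 ()
  asy a12 ()
  asy a23 ()
  asy a34 ()
  asy a40 ()
  asy b02 ()
  asy b13 ()
  asy b24 ()
  asy b30 ()
  asy b41 ()

TV : ℕ → ℕ → ℕ → Set
TV a b c = Fin a ⊎ Fin b ⊎ Fin c

data T-arc {a b c : ℕ} : TV a b c → TV a b c → Set where
  inA : ∀ {i j} → i < j → T-arc (inj₁ i) (inj₁ j)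
  inB : ∀ {i j} → i < j → T-arc (inj₂ (inj₁ i)) (inj₂ (inj₁ j))
  inC : ∀ {i j} → i < j → T-arc (inj₂ (inj₂ i)) (inj₂ (inj₂ j))
  AB  : ∀ {i j} → T-arc (inj₁ i) (inj₂ (inj₁ j))
  BC  : ∀ {i j} → T-arc (inj₂ (inj₁ i)) (inj₂ (inj₂ j))
  CA  : ∀ {i j} → T-arc (inj₂ (inj₂ i)) (inj₁ j)

private
  open import Data.Fin.Properties using (<-irrefl; <-asym; <-cmp)
  open import Relation.Binary.Definitions using (tri<; tri≈; tri>)
  open import Relation.Binary.PropositionalEquality using (refl; cong)

  T-irrefl : ∀ {a b c} {u : TV a b c} → ¬ T-arc u u
  T-irrefl (inA p) = <-irrefl refl p
  T-irrefl (inB p) = <-irrefl refl p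
  T-irrefl (inC p) = <-irrefl refl p

  T-asym : ∀ {a b c} {u v : TV a b c} → T-arc u v → ¬ T-arc v u
  T-asym (inA p) (inA q) = <-asym p q
  T-asym (inB p) (inB q) = <-asym p q
  T-asym (inC p) (inC q) = <-asym p q
  T-asym AB ()
  T-asym BC ()
  T-asym CA ()

  T-total : ∀ {a b c} {u v : TV a b c} → u ≢ v → T-arc u v ⊎ T-arc v u
  T-total {u = inj₁ i} {inj₁ j} ne with <-cmp i j
  ... | tri< p _ _ = inj₁ (inA p)
  ... | tri≈ _ e _ with ne (cong inj₁ e)
  ...   | ()
  T-total {u = inj₁ i} {inj₁ j} ne | tri> _ _ p = inj₂ (inA p)
  T-total {u = inj₁ i} {inj₂ (inj₁ j)} _ = inj₁ AB
  T-total {u = inj₁ i} {inj₂ (inj₂ j)} _ = inj₂ CA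
  T-total {u = inj₂ (inj₁ i)} {inj₁ j} _ = inj₂ AB
  T-total {u = inj₂ (inj₁ i)} {inj₂ (inj₁ j)} ne with <-cmp i j
  ... | tri< p _ _ = inj₁ (inB p)
  ... | tri≈ _ e _ with ne (cong (λ x → inj₂ (inj₁ x)) e)
  ...   | ()
  T-total {u = inj₂ (inj₁ i)} {inj₂ (inj₁ j)} ne | tri> _ _ p = inj₂ (inB p)
  T-total {u = inj₂ (inj₁ i)} {inj₂ (inj₂ j)} _ = inj₁ BC
  T-total {u = inj₂ (inj₂ i)} {inj₁ j} _ = inj₁ CA
  T-total {u = inj₂ (inj₂ i)} {inj₂ (inj₁ j)} _ = inj₂ BC
  T-total {u = inj₂ (inj₂ i)} {inj₂ (inj₂ j)} ne with <-cmp i j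
  ... | tri< p _ _ = inj₁ (inC p)
  ... | tri≈ _ e _ with ne (cong (λ x → inj₂ (inj₂ x)) e)
  ...   | ()
  T-total {u = inj₂ (inj₂ i)} {inj₂ (inj₂ j)} ne | tri> _ _ p = inj₂ (inC p)

private
  open import Data.Fin.Properties using (_<?_)
  T-dec : ∀ {a b c} (u v : TV a b c) → Dec (T-arc u v)
  T-dec (inj₁ i) (inj₁ j) with i <? j
  ... | yes p = yes (inA p)
  ... | no np = no λ { (inA p) → np p }
  T-dec (inj₁ i) (inj₂ (inj₁ j)) = yes AB
  T-dec (inj₁ i) (inj₂ (inj₂ j)) = no λ ()
  T-dec (inj₂ (inj₁ i)) (inj₁ j) = no λ ()
  T-dec (inj₂ (inj₁ i)) (inj₂ (inj₁ j)) with i <? j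
  ... | yes p = yes (inB p)
  ... | no np = no λ { (inB p) → np p }
  T-dec (inj₂ (inj₁ i)) (inj₂ (inj₂ j)) = yes BC
  T-dec (inj₂ (inj₂ i)) (inj₁ j) = yes CA
  T-dec (inj₂ (inj₂ i)) (inj₂ (inj₁ j)) = no λ ()
  T-dec (inj₂ (inj₂ i)) (inj₂ (inj₂ j)) with i <? j
  ... | yes p = yes (inC p)
  ... | no np = no λ { (inC p) → np p }

T[_,_,_] : (a b c : ℕ) → Tournament (TV a b c)
T[ a , b , c ] = record { arc = T-arc ; irrefl = T-irrefl ; asym = T-asym ; total = T-total ; dec = T-dec }

{-# OPTIONS --safe #-}
module Submission where

open import Defs
open import Level using (0ℓ)
open import Data.Nat using (ℕ; zero; suc; _+_; _≤_; _<_; _≥_; z≤n; s≤s)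
open import Data.Nat.Properties using (m≤n⇒m≤1+n; +-suc; ≤-trans; <⇒≱; module ≤-Reasoning)
open import Data.Fin using (Fin; zero; suc; fromℕ<; punchOut)
import Data.Fin as Fin
open import Data.Fin.Properties using (_≟_; any?; toℕ-fromℕ<; punchOut-injective; injective⇒≤; +↔⊎)
open import Data.Product using (Σ; ∃; _×_; _,_; proj₁; proj₂)
open import Data.Sum using (_⊎_; inj₁; inj₂)
open import Data.Sum.Function.Propositional using (_⊎-↔_)
open import Data.Empty using (⊥-elim)
open import Data.Vec using (_∷_; []; lookup)
open import Function using (_∘_)
open import Function.Bundles using (_↔_; Inverse; mk⤖; Injection)
open import Function.Definitions using (Injective; StrictlySurjective)
open import Function.Consequences.Propositional using (strictlySurjective⇒surjective)
open import Function.Properties.Inverse using (↔⇒↣)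
open import Function.Construct.Identity using (↔-id)
open import Function.Construct.Composition using (_↔-∘_)
open import Function.Construct.Symmetry using (↔-sym)
open import Relation.Unary using (Pred; Decidable; Satisfiable; _⊆_; _∩_; Empty)
open import Relation.Unary.Properties using (_∪?_; ∅?)
open import Relation.Nullary using (¬_; yes; no; contradiction)
open import Relation.Nullary.Decidable using (_×-dec_)
open import Relation.Binary.Definitions using (DecidableEquality)
open import Relation.Binary.PropositionalEquality using (_≡_; _≢_; refl; sym; trans; cong; subst; subst₂)

-- A non-transitive tournament contains a cyclic triangle x → y → z → x. Since W₄ and
-- L₄ are excluded, every vertex v lies in one of A = {z → v → y}, B = {x → v → z},
-- C = {y → v → x}, i.e. can take the place of x, y or z in the triangle. Each part
-- lies in the in-neighbourhood of a single vertex, which is transitive as L₄ is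
-- excluded, and excluding W₄ and C₅ forces every arc between parts to go
-- A → B → C → A. Ranking each part by its own order identifies T with T[|A|,|B|,|C|].

count : ∀ {n} {P : Pred (Fin n) 0ℓ} → Decidable P → ℕ
count {zero}  P? = 0
count {suc n} P? with P? zero
... | yes _ = suc (count (P? ∘ suc))
... | no  _ = count (P? ∘ suc)

count-mono : ∀ {n} {P Q : Pred (Fin n) 0ℓ} (P? : Decidable P) (Q? : Decidable Q) →
             P ⊆ Q → count P? ≤ count Q?
count-mono {zero}  _  _  _   = z≤n
count-mono {suc n} P? Q? P⊆Q with P? zero | Q? zero
... | yes p | no ¬q = contradiction (P⊆Q p) ¬q
... | yes _ | yes _ = s≤s (count-mono (P? ∘ suc) (Q? ∘ suc) P⊆Q)
... | no  _ | yes _ = m≤n⇒m≤1+n (count-mono (P? ∘ suc) (Q? ∘ suc) P⊆Q)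
... | no  _ | no  _ = count-mono (P? ∘ suc) (Q? ∘ suc) P⊆Q

count-strictMono : ∀ {n} {P Q : Pred (Fin n) 0ℓ} (P? : Decidable P) (Q? : Decidable Q) →
                   P ⊆ Q → ∀ j → Q j → ¬ P j → count P? < count Q?
count-strictMono {suc n} P? Q? P⊆Q zero qj ¬pj with P? zero | Q? zero
... | yes p | _     = contradiction p ¬pj
... | no  _ | yes _ = s≤s (count-mono (P? ∘ suc) (Q? ∘ suc) P⊆Q)
... | no  _ | no ¬q = contradiction qj ¬q
count-strictMono {suc n} P? Q? P⊆Q (suc j) qj ¬pj with P? zero | Q? zero
... | yes p | no ¬q = contradiction (P⊆Q p) ¬q
... | yes _ | yes _ = s≤s (count-strictMono (P? ∘ suc) (Q? ∘ suc) P⊆Q j qj ¬pj)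
... | no  _ | yes _ = m≤n⇒m≤1+n (count-strictMono (P? ∘ suc) (Q? ∘ suc) P⊆Q j qj ¬pj)
... | no  _ | no  _ = count-strictMono (P? ∘ suc) (Q? ∘ suc) P⊆Q j qj ¬pj

count-∪ : ∀ {n} {P Q : Pred (Fin n) 0ℓ} (P? : Decidable P) (Q? : Decidable Q) →
          Empty (P ∩ Q) → count (P? ∪? Q?) ≡ count P? + count Q?
count-∪ {zero}  _  _  _        = refl
count-∪ {suc n} P? Q? disjoint with P? zero | Q? zero
... | yes p | yes q = ⊥-elim (disjoint zero (p , q))
... | yes _ | no  _ = cong suc (count-∪ (P? ∘ suc) (Q? ∘ suc) (disjoint ∘ suc))
... | no  _ | yes _ =
  trans (cong suc (count-∪ (P? ∘ suc) (Q? ∘ suc) (disjoint ∘ suc))) (sym (+-suc _ _))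
... | no  _ | no  _ = count-∪ (P? ∘ suc) (Q? ∘ suc) (disjoint ∘ suc)

count≤n : ∀ {n} {P : Pred (Fin n) 0ℓ} (P? : Decidable P) → count P? ≤ n
count≤n {zero}  P? = z≤n
count≤n {suc n} P? with P? zero
... | yes _ = s≤s (count≤n (P? ∘ suc))
... | no  _ = m≤n⇒m≤1+n (count≤n (P? ∘ suc))

satisfiable⇒count≥1 : ∀ {n} {P : Pred (Fin n) 0ℓ} (P? : Decidable P) → Satisfiable P → count P? ≥ 1
satisfiable⇒count≥1 P? (j , pj) = ≤-trans (s≤s z≤n) (count-strictMono ∅? P? (λ ()) j pj (λ ()))

injective⇒strictlySurjective : ∀ {n m} {f : Fin n → Fin m} →
                               m ≤ n → Injective _≡_ _≡_ f → StrictlySurjective _≡_ f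
injective⇒strictlySurjective {m = suc m} {f} m<n f-injective k with any? (λ i → f i ≟ k)
... | yes hit  = hit
... | no  miss = contradiction (injective⇒≤ punchOut∘f-injective) (<⇒≱ m<n)
  where
  k≢f : ∀ i → k ≢ f i
  k≢f i k≡fi = miss (i , sym k≡fi)

  punchOut∘f-injective : Injective _≡_ _≡_ (λ i → punchOut (k≢f i))
  punchOut∘f-injective {i} {j} = f-injective ∘ punchOut-injective (k≢f i) (k≢f j)

TransitiveOn : ∀ {V} → Tournament V → Pred V 0ℓ → Set
TransitiveOn T P = ∀ {u v w} → P u → P v → P w → arc T u v → arc T v w → arc T u w

Preserves : ∀ {U W} → Tournament U → Tournament W → (U → W) → Set
Preserves S T f = ∀ {u v} → arc S u v → arc T (f u) (f v)

-- Distinct vertices are joined by an arc, so an arc-preserving map of tournaments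
-- is injective and reflects arcs.
module _ {U W : Set} (S : Tournament U) (T : Tournament W) (_≟ᵤ_ : DecidableEquality U)
         {f : U → W} (f-preserves : Preserves S T f) where

  preserves⇒injective : Injective _≡_ _≡_ f
  preserves⇒injective {u} {v} fu≡fv with u ≟ᵤ v
  ... | yes u≡v = u≡v
  ... | no  u≢v with total S u≢v
  ...   | inj₁ uv = ⊥-elim (irrefl T (subst (arc T (f u)) (sym fu≡fv) (f-preserves uv)))
  ...   | inj₂ vu = ⊥-elim (irrefl T (subst (arc T (f v)) fu≡fv (f-preserves vu)))

  preserves⇒reflects : ∀ u v → arc T (f u) (f v) → arc S u v
  preserves⇒reflects u v fu→fv with u ≟ᵤ v
  ... | yes refl = ⊥-elim (irrefl T fu→fv)
  ... | no  u≢v with total S u≢v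
  ...   | inj₁ uv = uv
  ...   | inj₂ vu = ⊥-elim (asym T fu→fv (f-preserves vu))

  preserves⇒⊑ : S ⊑ T
  preserves⇒⊑ = f , preserves⇒injective , λ u v → f-preserves , preserves⇒reflects u v

  preserves⇒≅ : StrictlySurjective _≡_ f → S ≅ T
  preserves⇒≅ f-surjective =
    mk⤖ (preserves⇒injective , strictlySurjective⇒surjective f-surjective) ,
    λ u v → f-preserves , preserves⇒reflects u v

module Configurations {V : Set} (T : Tournament V) where

  infix 4 _⇒_
  _⇒_ : V → V → Set
  u ⇒ v = arc T u v

  W₄⊑ : ∀ {s a b c} → s ⇒ a → s ⇒ b → s ⇒ c → a ⇒ b → b ⇒ c → c ⇒ a → W₄ ⊑ T
  W₄⊑ {s} {a} {b} {c} sa sb sc ab bc ca = preserves⇒⊑ W₄ T _≟_ vertex-preserves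
    where
    vertex-preserves : Preserves W₄ T (lookup (s ∷ a ∷ b ∷ c ∷ []))
    vertex-preserves s1  = sa
    vertex-preserves s2  = sb
    vertex-preserves s3  = sc
    vertex-preserves c12 = ab
    vertex-preserves c23 = bc
    vertex-preserves c31 = ca

  L₄⊑ : ∀ {s a b c} → a ⇒ s → b ⇒ s → c ⇒ s → a ⇒ b → b ⇒ c → c ⇒ a → L₄ ⊑ T
  L₄⊑ {s} {a} {b} {c} as bs cs ab bc ca = preserves⇒⊑ L₄ T _≟_ vertex-preserves
    where
    vertex-preserves : Preserves L₄ T (lookup (s ∷ a ∷ b ∷ c ∷ []))
    vertex-preserves s1  = as
    vertex-preserves s2  = bs
    vertex-preserves s3  = cs
    vertex-preserves c12 = ab
    vertex-preserves c23 = bc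
    vertex-preserves c31 = ca

  C₅⊑ : ∀ {v₀ v₁ v₂ v₃ v₄} →
        v₀ ⇒ v₁ → v₁ ⇒ v₂ → v₂ ⇒ v₃ → v₃ ⇒ v₄ → v₄ ⇒ v₀ →
        v₀ ⇒ v₂ → v₁ ⇒ v₃ → v₂ ⇒ v₄ → v₃ ⇒ v₀ → v₄ ⇒ v₁ → C₅ ⊑ T
  C₅⊑ {v₀} {v₁} {v₂} {v₃} {v₄} e01 e12 e23 e34 e40 e02 e13 e24 e30 e41 =
    preserves⇒⊑ C₅ T _≟_ vertex-preserves
    where
    vertex-preserves : Preserves C₅ T (lookup (v₀ ∷ v₁ ∷ v₂ ∷ v₃ ∷ v₄ ∷ []))
    vertex-preserves a01 = e01
    vertex-preserves a12 = e12
    vertex-preserves a23 = e23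
    vertex-preserves a34 = e34
    vertex-preserves a40 = e40
    vertex-preserves b02 = e02
    vertex-preserves b13 = e13
    vertex-preserves b24 = e24
    vertex-preserves b30 = e30
    vertex-preserves b41 = e41

  in-neighbourhood-transitive : ¬ L₄ ⊑ T → ∀ y → TransitiveOn T (_⇒ y)
  in-neighbourhood-transitive ¬L₄ y {u} {v} {w} uy vy wy uv vw
    with total T (λ { refl → asym T uv vw })
  ... | inj₁ uw = uw
  ... | inj₂ wu = contradiction (L₄⊑ uy vy wy uv vw wu) ¬L₄

  Between : V → V → Pred V 0ℓ
  Between z y v = z ⇒ v × v ⇒ y

  between-transitive : ¬ L₄ ⊑ T → ∀ z y → TransitiveOn T (Between z y)
  between-transitive ¬L₄ z y (_ , uy) (_ , vy) (_ , wy) =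
    in-neighbourhood-transitive ¬L₄ y uy vy wy

  between-⇒ : ¬ W₄ ⊑ T → ¬ C₅ ⊑ T → ∀ {x y z a b} → x ⇒ y → y ⇒ z → z ⇒ x →
              Between z y a → Between x z b → a ⇒ b
  between-⇒ ¬W₄ ¬C₅ {x} {y} {z} {a} {b} xy yz zx (za , ay) (xb , bz)
    with total T (λ { refl → asym T za bz })
  ... | inj₁ ab = ab
  ... | inj₂ ba with total T (λ { refl → asym T ay ba })
  ...   | inj₁ by = contradiction (W₄⊑ by bz ba yz za ay) ¬W₄
  ...   | inj₂ yb with total T (λ { refl → asym T xb ba })
  ...     | inj₁ ax = contradiction (C₅⊑ xy yb bz za ax xb yz ba zx ay) ¬C₅
  ...     | inj₂ xa = contradiction (W₄⊑ xy xb xa yb ba ay) ¬W₄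

  trichotomy : DecidableEquality V → ∀ u v → u ≡ v ⊎ u ⇒ v ⊎ v ⇒ u
  trichotomy _≟ᵥ_ u v with u ≟ᵥ v
  ... | yes u≡v = inj₁ u≡v
  ... | no  u≢v = inj₂ (total T u≢v)

  between-cover : DecidableEquality V → ¬ W₄ ⊑ T → ¬ L₄ ⊑ T →
                  ∀ {x y z} → x ⇒ y → y ⇒ z → z ⇒ x →
                  ∀ v → Between z y v ⊎ Between x z v ⊎ Between y x v
  between-cover _≟ᵥ_ ¬W₄ ¬L₄ {x} {y} {z} xy yz zx v
    with trichotomy _≟ᵥ_ v x | trichotomy _≟ᵥ_ v y | trichotomy _≟ᵥ_ v z
  ... | inj₁ refl      | _              | _              = inj₁ (zx , xy)
  ... | _              | inj₁ refl      | _              = inj₂ (inj₁ (xy , yz))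
  ... | _              | _              | inj₁ refl      = inj₂ (inj₂ (yz , zx))
  ... | inj₂ (inj₁ vx) | inj₂ (inj₁ vy) | inj₂ (inj₁ vz) = contradiction (W₄⊑ vx vy vz xy yz zx) ¬W₄
  ... | inj₂ (inj₂ xv) | inj₂ (inj₂ yv) | inj₂ (inj₂ zv) = contradiction (L₄⊑ xv yv zv xy yz zx) ¬L₄
  ... | _              | inj₂ (inj₁ vy) | inj₂ (inj₂ zv) = inj₁ (zv , vy)
  ... | inj₂ (inj₂ xv) | _              | inj₂ (inj₁ vz) = inj₂ (inj₁ (xv , vz))
  ... | inj₂ (inj₁ vx) | inj₂ (inj₂ yv) | _              = inj₂ (inj₂ (yv , vx))

CyclicTriangle : ∀ {V} → Tournament V → Set
CyclicTriangle T = ∃ λ x → ∃ λ y → ∃ λ z → arc T x y × arc T y z × arc T z x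

nontransitive⇒cyclicTriangle : ∀ {n} (T : Tournament (Fin n)) → ¬ IsTransitive T → CyclicTriangle T
nontransitive⇒cyclicTriangle T ¬transitive
  with any? (λ x → any? (λ y → any? (λ z → dec T x y ×-dec dec T y z ×-dec dec T z x)))
... | yes triangle   = triangle
... | no  ¬triangle = ⊥-elim (¬transitive transitive)
  where
  transitive : IsTransitive T
  transitive {u} {v} {w} uv vw with total T (λ { refl → asym T uv vw })
  ... | inj₁ uw = uw
  ... | inj₂ wu = contradiction (u , v , w , uv , vw , wu) ¬triangle

module Ranking {n} (T : Tournament (Fin n)) {P : Pred (Fin n) 0ℓ} (P? : Decidable P)
               (P-transitive : TransitiveOn T P) where

  BeatenBy : Fin n → Pred (Fin n) 0ℓ
  BeatenBy v w = P w × arc T w v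

  beatenBy? : ∀ v → Decidable (BeatenBy v)
  beatenBy? v w = P? w ×-dec dec T w v

  rank : Fin n → ℕ
  rank v = count (beatenBy? v)

  rank<count : ∀ {v} → P v → rank v < count P?
  rank<count {v} pv = count-strictMono (beatenBy? v) P? proj₁ v pv (irrefl T ∘ proj₂)

  rank-strictMono : ∀ {u v} → P u → P v → arc T u v → rank u < rank v
  rank-strictMono {u} {v} pu pv uv =
    count-strictMono (beatenBy? u) (beatenBy? v) beatenBy-u⊆beatenBy-v u (pu , uv) (irrefl T ∘ proj₂)
    where
    beatenBy-u⊆beatenBy-v : BeatenBy u ⊆ BeatenBy v
    beatenBy-u⊆beatenBy-v (pw , wu) = pw , P-transitive pw pu pv wu uv

  index : ∀ {v} → P v → Fin (count P?)
  index pv = fromℕ< (rank<count pv)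

  index-strictMono : ∀ {u v} (pu : P u) (pv : P v) → arc T u v → index pu Fin.< index pv
  index-strictMono pu pv uv =
    subst₂ _<_ (sym (toℕ-fromℕ< (rank<count pu))) (sym (toℕ-fromℕ< (rank<count pv)))
      (rank-strictMono pu pv uv)

record CyclicPartition {n} (T : Tournament (Fin n)) : Set₁ where
  field
    A B C        : Pred (Fin n) 0ℓ
    A?           : Decidable A
    B?           : Decidable B
    C?           : Decidable C
    cover        : ∀ v → A v ⊎ B v ⊎ C v
    A⇒B          : ∀ {u v} → A u → B v → arc T u v
    B⇒C          : ∀ {u v} → B u → C v → arc T u v
    C⇒A          : ∀ {u v} → C u → A v → arc T u v
    A-transitive : TransitiveOn T A
    B-transitive : TransitiveOn T B
    C-transitive : TransitiveOn T C

module _ {n} {T : Tournament (Fin n)} (D : CyclicPartition T) where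
  open CyclicPartition D
  private
    module RA = Ranking T A? A-transitive
    module RB = Ranking T B? B-transitive
    module RC = Ranking T C? C-transitive

  place : ∀ {v} → A v ⊎ B v ⊎ C v → TV (count A?) (count B?) (count C?)
  place (inj₁ p)        = inj₁ (RA.index p)
  place (inj₂ (inj₁ p)) = inj₂ (inj₁ (RB.index p))
  place (inj₂ (inj₂ p)) = inj₂ (inj₂ (RC.index p))

  place-preserves : ∀ {u v} (p : A u ⊎ B u ⊎ C u) (q : A v ⊎ B v ⊎ C v) →
                    arc T u v → T-arc (place p) (place q)
  place-preserves (inj₁ p)        (inj₁ q)        uv = inA (RA.index-strictMono p q uv)
  place-preserves (inj₁ _)        (inj₂ (inj₁ _)) _  = AB
  place-preserves (inj₁ p)        (inj₂ (inj₂ q)) uv = ⊥-elim (asym T uv (C⇒A q p))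
  place-preserves (inj₂ (inj₁ p)) (inj₁ q)        uv = ⊥-elim (asym T uv (A⇒B q p))
  place-preserves (inj₂ (inj₁ p)) (inj₂ (inj₁ q)) uv = inB (RB.index-strictMono p q uv)
  place-preserves (inj₂ (inj₁ _)) (inj₂ (inj₂ _)) _  = BC
  place-preserves (inj₂ (inj₂ _)) (inj₁ _)        _  = CA
  place-preserves (inj₂ (inj₂ p)) (inj₂ (inj₁ q)) uv = ⊥-elim (asym T uv (B⇒C q p))
  place-preserves (inj₂ (inj₂ p)) (inj₂ (inj₂ q)) uv = inC (RC.index-strictMono p q uv)

  count-parts≤n : count A? + (count B? + count C?) ≤ n
  count-parts≤n = begin
    count A? + (count B? + count C?)  ≡⟨ cong (count A? +_) (count-∪ B? C? B∩C=∅) ⟨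
    count A? + count (B? ∪? C?)       ≡⟨ count-∪ A? (B? ∪? C?) A∩[B∪C]=∅ ⟨
    count (A? ∪? (B? ∪? C?))          ≤⟨ count≤n _ ⟩
    n                                  ∎
    where
    open ≤-Reasoning
    B∩C=∅ : Empty (B ∩ C)
    B∩C=∅ v (b , c) = irrefl T (B⇒C b c)
    A∩[B∪C]=∅ : Empty (A ∩ (λ v → B v ⊎ C v))
    A∩[B∪C]=∅ v (a , inj₁ b) = irrefl T (A⇒B a b)
    A∩[B∪C]=∅ v (a , inj₂ c) = irrefl T (C⇒A c a)

  cyclicPartition⇒≅ : T ≅ T[ count A? , count B? , count C? ]
  cyclicPartition⇒≅ = preserves⇒≅ T T[ count A? , count B? , count C? ] _≟_ F-preserves F-surjective
    where
    F : Fin n → TV (count A?) (count B?) (count C?)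
    F v = place (cover v)

    F-preserves : Preserves T T[ count A? , count B? , count C? ] F
    F-preserves {u} {v} = place-preserves (cover u) (cover v)

    TV↔Fin : TV (count A?) (count B?) (count C?) ↔ Fin (count A? + (count B? + count C?))
    TV↔Fin = ↔-sym ((↔-id _ ⊎-↔ +↔⊎) ↔-∘ +↔⊎)

    open Inverse TV↔Fin using (to)

    to-injective : Injective _≡_ _≡_ to
    to-injective = Injection.injective (↔⇒↣ TV↔Fin)

    F-injective : Injective _≡_ _≡_ F
    F-injective = preserves⇒injective T T[ count A? , count B? , count C? ] _≟_ F-preserves

    F-surjective : StrictlySurjective _≡_ F
    F-surjective t with injective⇒strictlySurjective count-parts≤n (F-injective ∘ to-injective) (to t)
    ... | v , to[Fv]≡to[t] = v , to-injective to[Fv]≡to[t]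

lemma3 : (n : ℕ) (T : Tournament (Fin n)) →
           ¬ IsTransitive T → ¬ (W₄ ⊑ T) → ¬ (L₄ ⊑ T) → ¬ (C₅ ⊑ T) →
           Σ ℕ λ a → Σ ℕ λ b → Σ ℕ λ c →
             (a ≥ 1) × (b ≥ 1) × (c ≥ 1) × (T ≅ T[ a , b , c ])
lemma3 n T ¬transitive ¬W₄ ¬L₄ ¬C₅ with nontransitive⇒cyclicTriangle T ¬transitive
... | x , y , z , xy , yz , zx =
  count A? , count B? , count C? ,
  satisfiable⇒count≥1 A? (x , zx , xy) ,
  satisfiable⇒count≥1 B? (y , xy , yz) ,
  satisfiable⇒count≥1 C? (z , yz , zx) ,
  cyclicPartition⇒≅ partition
  where
  open Configurations T

  between? : ∀ z y → Decidable (Between z y)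
  between? z y v = dec T z v ×-dec dec T v y

  A? : Decidable (Between z y)
  A? = between? z y

  B? : Decidable (Between x z)
  B? = between? x z

  C? : Decidable (Between y x)
  C? = between? y x

  partition : CyclicPartition T
  partition = record
    { A? = A? ; B? = B? ; C? = C?
    ; cover = between-cover _≟_ ¬W₄ ¬L₄ xy yz zx
    ; A⇒B = between-⇒ ¬W₄ ¬C₅ xy yz zx
    ; B⇒C = between-⇒ ¬W₄ ¬C₅ yz zx xy
    ; C⇒A = between-⇒ ¬W₄ ¬C₅ zx xy yz
    ; A-transitive = between-transitive ¬L₄ z y
    ; B-transitive = between-transitive ¬L₄ x z
    ; C-transitive = between-transitive ¬L₄ y x
    }
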